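{- Let $n$ be an even positive integer. Then $\dim \Omega_n^{\pi}=\frac{(n-1)^2+1}{2}$.
   Context: For an $n\times n$ matrix $A=[a_{ij}]$, $A^{\pi}$ is the matrix whose $(i,j)$ entry is $a_{n+1-i,n+1-j}$; $A$ is centrosymmetric if $A^{\pi}=A$. A doubly stochastic matrix is a real matrix with nonnegative entries all of whose row and column sums equal $1$. $\Omega_n^{\pi}$ denotes the convex polytope of all $n\times n$ centrosymmetric doubly stochastic matrices, and its dimension is the dimension of its affine hull.
   Formalization: The matrices in $\Omega_n^{\pi}$ have rational entries instead of real ones, and affine independence of its points, which defines its dimension, is taken over ℚ. -}

module Defs where

open import Data.Nat using (ℕ; zero; suc)
open import Data.Fin using (Fin; zero; suc; opposite)
open import Data.Rational using (ℚ; 0ℚ; 1ℚ; _+_; _*_; _≤_)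
open import Data.Product using (Σ; _×_)
open import Relation.Binary.PropositionalEquality using (_≡_)
open import Relation.Nullary using (¬_)

∑ : ∀ {k} → (Fin k → ℚ) → ℚ
∑ {zero}  f = 0ℚ
∑ {suc k} f = f zero + ∑ (λ i → f (suc i))

Matrix : ℕ → Set
Matrix n = Fin n → Fin n → ℚ

-- A^π : (i,j) entry is a_{n+1-i, n+1-j}; with 0-based indices, opposite i = n-1-i.
_^π : ∀ {n} → Matrix n → Matrix n
(A ^π) i j = A (opposite i) (opposite j)

Centrosymmetric : ∀ {n} → Matrix n → Set
Centrosymmetric A = ∀ i j → (A ^π) i j ≡ A i j

DoublyStochastic : ∀ {n} → Matrix n → Set
DoublyStochastic {n} A =
  (∀ i j → 0ℚ ≤ A i j) ×
  (∀ i → ∑ (λ j → A i j) ≡ 1ℚ) ×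
  (∀ j → ∑ (λ i → A i j) ≡ 1ℚ)

Ωπ : (n : ℕ) → Matrix n → Set
Ωπ n A = Centrosymmetric A × DoublyStochastic A

AffinelyIndependent : ∀ {n k} → (Fin k → Matrix n) → Set
AffinelyIndependent {n} {k} P =
  (c : Fin k → ℚ) →
  ∑ c ≡ 0ℚ →
  (∀ i j → ∑ (λ l → c l * P l i j) ≡ 0ℚ) →
  ∀ l → c l ≡ 0ℚ

HasAffIndep : ∀ {n} → (Matrix n → Set) → ℕ → Set
HasAffIndep {n} S k =
  Σ (Fin k → Matrix n) λ P → (∀ l → S (P l)) × AffinelyIndependent P

AffDim : ∀ {n} → (Matrix n → Set) → ℕ → Set
AffDim S d = HasAffIndep S (suc d) × ¬ HasAffIndep S (suc (suc d))

{-# OPTIONS --safe #-}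
module Submission where

-- Write n = 2m. The affine hull of Ωπ_n is a translate of the space T of centrosymmetric
-- matrices with zero row and column sums. A matrix of T is determined by its entries in rows
-- 1, …, m-1 outside column 0 and in the first m columns of row 0: row sums give column 0,
-- centrosymmetry gives the bottom half, and since column j and column n-1-j then carry the same
-- sum condition, row 0 is antisymmetric under j ↦ n-1-j. These D = (m-1)(2m-1) + m
-- = ((n-1)² + 1)/2 coordinates bound the dimension by D. Conversely, centrosymmetrised exchange matrices
-- (e_x - e_x′)(e_y - e_y′)ᵀ give D elements of T that are triangular in these coordinates,
-- and small multiples of them added to the uniform matrix stay in Ωπ_n.

open import Defs

-- Rational arithmetic is opened only inside this module, so that _+_ in the final statement
-- is the one on ℕ.
module _ where

  open import Algebra.Bundles using (CommutativeMonoid)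
  open import Data.Fin using (Fin; zero; suc; opposite; punchIn; punchOut; toℕ; _↑ˡ_; _↑ʳ_; splitAt)
  import Data.Fin.Properties as Finₚ
  open import Data.Nat as ℕ using (ℕ; zero; suc; _∸_; _^_; _/_)
  open import Data.Nat.DivMod using (m*n/n≡m)
  import Data.Nat.Properties as ℕₚ
  import Data.Nat.Solver as ℕ-Solver
  open import Data.Product using (_×_; _,_; proj₁; proj₂; uncurry)
  open import Data.Rational as ℚ using (ℚ; 0ℚ; 1ℚ; _+_; _*_; _-_; -_; 1/_; _≤_; NonZero; Positive)
  import Data.Rational.Properties as ℚₚ
  open import Data.Rational.Solver using (module +-*-Solver)
  open import Data.Sum using (_⊎_; inj₁; inj₂)
  open import Data.Sum.Function.Propositional using (_⊎-↔_)
  open import Data.Vec.Functional using (insertAt)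
  open import Data.Vec.Functional.Properties using (insertAt-lookup; insertAt-punchIn)
  open import Function using (_∘_; _↔_; Inverse)
  open import Function.Properties.Inverse using (↔-refl; ↔-trans)
  open import Relation.Binary.PropositionalEquality
  open import Relation.Nullary using (¬_; yes; no; contradiction)
  open import Relation.Nullary.Decidable using (¬?; decidable-stable)

  open import Algebra.Definitions.RawMonoid ℚ.+-0-rawMonoid using () renaming (_×_ to _×ₙ_)
  open import Algebra.Properties.CommutativeSemigroup
    (CommutativeMonoid.commutativeSemigroup ℚₚ.+-0-commutativeMonoid) using (interchange; x∙yz≈y∙xz)

  x*y≡0⇒x≡0 : ∀ x {y} → y ≢ 0ℚ → x * y ≡ 0ℚ → x ≡ 0ℚ
  x*y≡0⇒x≡0 x {y} y≢0 xy≡0 = begin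
    x                  ≡⟨ ℚₚ.*-identityʳ x ⟨
    x * 1ℚ             ≡⟨ cong (x *_) (ℚₚ.*-inverseʳ y) ⟨
    x * (y * 1/ y)     ≡⟨ ℚₚ.*-assoc x y (1/ y) ⟨
    x * y * 1/ y       ≡⟨ cong (_* 1/ y) xy≡0 ⟩
    0ℚ * 1/ y          ≡⟨ ℚₚ.*-zeroˡ (1/ y) ⟩
    0ℚ                 ∎
    where
    open ≡-Reasoning
    instance _ = ℚ.≢-nonZero y≢0

  x≡0⇒x*y≡0 : ∀ {x} y → x ≡ 0ℚ → x * y ≡ 0ℚ
  x≡0⇒x*y≡0 y refl = ℚₚ.*-zeroˡ y

  y≡0⇒x*y≡0 : ∀ x {y} → y ≡ 0ℚ → x * y ≡ 0ℚ
  y≡0⇒x*y≡0 x refl = ℚₚ.*-zeroʳ x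

  suc×ₙ1-positive : ∀ l → Positive (suc l ×ₙ 1ℚ)
  suc×ₙ1-positive l = ℚₚ.pos+nonNeg⇒pos 1ℚ (l ×ₙ 1ℚ) {{nonNegative l}}
    where
    nonNegative : ∀ l → ℚ.NonNegative (l ×ₙ 1ℚ)
    nonNegative zero    = _
    nonNegative (suc l) = ℚₚ.pos⇒nonNeg (suc l ×ₙ 1ℚ) {{suc×ₙ1-positive l}}

  ∑-cong : ∀ {k} {f g : Fin k → ℚ} → (∀ i → f i ≡ g i) → ∑ f ≡ ∑ g
  ∑-cong {zero}  f≗g = refl
  ∑-cong {suc k} f≗g = cong₂ _+_ (f≗g zero) (∑-cong (f≗g ∘ suc))

  ∑-zero : ∀ {k} {f : Fin k → ℚ} → (∀ i → f i ≡ 0ℚ) → ∑ f ≡ 0ℚ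
  ∑-zero {zero}  f≗0 = refl
  ∑-zero {suc k} f≗0 = cong₂ _+_ (f≗0 zero) (∑-zero (f≗0 ∘ suc))

  ∑-distrib-+ : ∀ {k} (f g : Fin k → ℚ) → ∑ (λ i → f i + g i) ≡ ∑ f + ∑ g
  ∑-distrib-+ {zero}  f g = refl
  ∑-distrib-+ {suc k} f g =
    trans (cong (f zero + g zero +_) (∑-distrib-+ (f ∘ suc) (g ∘ suc)))
          (interchange (f zero) (g zero) (∑ (f ∘ suc)) (∑ (g ∘ suc)))

  ∑-neg : ∀ {k} (f : Fin k → ℚ) → ∑ (λ i → - f i) ≡ - ∑ f
  ∑-neg {zero}  f = refl
  ∑-neg {suc k} f =
    trans (cong (- f zero +_) (∑-neg (f ∘ suc))) (sym (ℚₚ.neg-distrib-+ (f zero) (∑ (f ∘ suc))))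

  ∑-distrib-minus : ∀ {k} (f g : Fin k → ℚ) → ∑ (λ i → f i - g i) ≡ ∑ f - ∑ g
  ∑-distrib-minus f g = trans (∑-distrib-+ f (λ i → - g i)) (cong (∑ f +_) (∑-neg g))

  *-distribˡ-∑ : ∀ {k} x (f : Fin k → ℚ) → x * ∑ f ≡ ∑ (λ i → x * f i)
  *-distribˡ-∑ {zero}  x f = ℚₚ.*-zeroʳ x
  *-distribˡ-∑ {suc k} x f =
    trans (ℚₚ.*-distribˡ-+ x (f zero) (∑ (f ∘ suc)))
          (cong (x * f zero +_) (*-distribˡ-∑ x (f ∘ suc)))

  *-distribʳ-∑ : ∀ {k} x (f : Fin k → ℚ) → ∑ f * x ≡ ∑ (λ i → f i * x)
  *-distribʳ-∑ {zero}  x f = ℚₚ.*-zeroˡ x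
  *-distribʳ-∑ {suc k} x f =
    trans (ℚₚ.*-distribʳ-+ x (f zero) (∑ (f ∘ suc)))
          (cong (f zero * x +_) (*-distribʳ-∑ x (f ∘ suc)))

  ∑-comm : ∀ {k l} (f : Fin k → Fin l → ℚ) →
           ∑ (λ i → ∑ (f i)) ≡ ∑ (λ j → ∑ (λ i → f i j))
  ∑-comm {zero}  {l} f = sym (∑-zero {l} (λ _ → refl))
  ∑-comm {suc k}     f =
    trans (cong (∑ (f zero) +_) (∑-comm (f ∘ suc))) (sym (∑-distrib-+ (f zero) _))

  ∑-replicate : ∀ {k} x → ∑ {k} (λ _ → x) ≡ (k ×ₙ 1ℚ) * x
  ∑-replicate {zero}  x = sym (ℚₚ.*-zeroˡ x)
  ∑-replicate {suc k} x = begin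
    x + ∑ {k} (λ _ → x)      ≡⟨ cong₂ _+_ (sym (ℚₚ.*-identityˡ x)) (∑-replicate {k} x) ⟩
    1ℚ * x + (k ×ₙ 1ℚ) * x   ≡⟨ ℚₚ.*-distribʳ-+ x 1ℚ (k ×ₙ 1ℚ) ⟨
    (1ℚ + k ×ₙ 1ℚ) * x       ∎
    where open ≡-Reasoning

  ∑-remove : ∀ {k} (p : Fin (suc k)) (f : Fin (suc k) → ℚ) → ∑ f ≡ f p + ∑ (f ∘ punchIn p)
  ∑-remove         zero    f = refl
  ∑-remove {suc k} (suc p) f =
    trans (cong (f zero +_) (∑-remove p (f ∘ suc))) (x∙yz≈y∙xz (f zero) (f (suc p)) _)

  ∑-single : ∀ {k} (p : Fin k) (f : Fin k → ℚ) →
             (∀ i → i ≢ p → f i ≡ 0ℚ) → ∑ f ≡ f p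
  ∑-single {suc k} p f f≗0 = begin
    ∑ f                       ≡⟨ ∑-remove p f ⟩
    f p + ∑ (f ∘ punchIn p)   ≡⟨ cong (f p +_) (∑-zero λ j → f≗0 _ (Finₚ.punchInᵢ≢i p j)) ⟩
    f p + 0ℚ                  ≡⟨ ℚₚ.+-identityʳ (f p) ⟩
    f p                       ∎
    where open ≡-Reasoning

  ∑-pair : ∀ {k} {p p′ : Fin k} (f : Fin k → ℚ) → p ≢ p′ →
           (∀ i → i ≢ p → i ≢ p′ → f i ≡ 0ℚ) → ∑ f ≡ f p + f p′
  ∑-pair {suc k} {p} {p′} f p≢p′ f≗0 = begin
    ∑ f                       ≡⟨ ∑-remove p f ⟩
    f p + ∑ (f ∘ punchIn p)   ≡⟨ cong (f p +_) (∑-single j (f ∘ punchIn p) f∘punchIn≗0) ⟩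
    f p + f (punchIn p j)     ≡⟨ cong (λ i → f p + f i) (Finₚ.punchIn-punchOut p≢p′) ⟩
    f p + f p′                ∎
    where
    open ≡-Reasoning
    j = punchOut p≢p′
    f∘punchIn≗0 : ∀ i → i ≢ j → f (punchIn p i) ≡ 0ℚ
    f∘punchIn≗0 i i≢j = f≗0 _ (Finₚ.punchInᵢ≢i p i) λ pi≡p′ →
      i≢j (Finₚ.punchIn-injective p i j (trans pi≡p′ (sym (Finₚ.punchIn-punchOut p≢p′))))

  -- Linear dependence

  record NontrivialRelation {m k} (v : Fin m → Fin k → ℚ) : Set where
    field
      coeff    : Fin m → ℚ
      support  : Fin m
      coeff≢0  : coeff support ≢ 0ℚ
      vanishes : ∀ t → ∑ (λ l → coeff l * v l t) ≡ 0ℚ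

  module _ {m k} (v : Fin (suc m) → Fin (suc k) → ℚ) where

    addZeroCoordinate : (∀ l → v l zero ≡ 0ℚ) →
                        NontrivialRelation (λ l t → v l (suc t)) → NontrivialRelation v
    addZeroCoordinate v≗0 r = record { NontrivialRelation r; vanishes = vanishes′ }
      where
      open NontrivialRelation r
      vanishes′ : ∀ t → ∑ (λ l → coeff l * v l t) ≡ 0ℚ
      vanishes′ zero    = ∑-zero λ l → y≡0⇒x*y≡0 (coeff l) (v≗0 l)
      vanishes′ (suc t) = vanishes t

    module _ (p : Fin (suc m)) .{{_ : NonZero (v p zero)}} where

      -- One step of Gaussian elimination on the first coordinate, with pivot vector v p.
      eliminate : Fin m → Fin k → ℚ
      eliminate j t = v (punchIn p j) (suc t) - v (punchIn p j) zero * 1/ v p zero * v p (suc t)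

      fromEliminated : NontrivialRelation eliminate → NontrivialRelation v
      fromEliminated r = record
        { coeff    = c
        ; support  = punchIn p support
        ; coeff≢0  = coeff≢0 ∘ trans (sym (insertAt-punchIn coeff p _ support))
        ; vanishes = vanishes′
        }
        where
        open NontrivialRelation r
        open +-*-Solver
        open ≡-Reasoning
        u = v ∘ punchIn p
        q = 1/ v p zero
        S = ∑ (λ j → coeff j * u j zero)
        -- The coefficient of v p is chosen to cancel the first coordinate.
        c = insertAt coeff p (- (S * q))

        split : ∀ t → ∑ (λ l → c l * v l t) ≡ - (S * q) * v p t + ∑ (λ j → coeff j * u j t)
        split t = trans (∑-remove p (λ l → c l * v l t)) (cong₂ _+_
          (cong (_* v p t) (insertAt-lookup coeff p _))
          (∑-cong λ j → cong (_* u j t) (insertAt-punchIn coeff p _ j)))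

        vanishes′ : ∀ t → ∑ (λ l → c l * v l t) ≡ 0ℚ
        vanishes′ zero = begin
          _                         ≡⟨ split zero ⟩
          - (S * q) * v p zero + S
            ≡⟨ solve 3 (λ S q a → :- (S :* q) :* a :+ S := S :* (con 1ℚ :- q :* a)) refl S q (v p zero) ⟩
          S * (1ℚ - q * v p zero)   ≡⟨ cong (λ x → S * (1ℚ - x)) (ℚₚ.*-inverseˡ (v p zero)) ⟩
          S * 0ℚ                    ≡⟨ ℚₚ.*-zeroʳ S ⟩
          0ℚ                        ∎
        vanishes′ (suc t) = begin
          _                         ≡⟨ split (suc t) ⟩
          - (S * q) * W + X
            ≡⟨ solve 4 (λ S q W X → :- (S :* q) :* W :+ X := X :- S :* (q :* W)) refl S q W X ⟩
          X - S * (q * W)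
            ≡⟨ cong (λ y → X - y) (*-distribʳ-∑ (q * W) (λ j → coeff j * u j zero)) ⟩
          X - ∑ (λ j → coeff j * u j zero * (q * W))
            ≡⟨ ∑-distrib-minus (λ j → coeff j * u j (suc t)) (λ j → coeff j * u j zero * (q * W)) ⟨
          ∑ (λ j → coeff j * u j (suc t) - coeff j * u j zero * (q * W))
            ≡⟨ ∑-cong (λ j → solve 5 (λ c a b q W → c :* a :- c :* b :* (q :* W)
                                                  := c :* (a :- b :* q :* W))
                                     refl (coeff j) (u j (suc t)) (u j zero) q W) ⟩
          ∑ (λ j → coeff j * eliminate j t) ≡⟨ vanishes t ⟩
          0ℚ                        ∎
          where
          W = v p (suc t)
          X = ∑ (λ j → coeff j * u j (suc t))

  k<m⇒dependent : ∀ {k m} → k ℕ.< m → (v : Fin m → Fin k → ℚ) → NontrivialRelation v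
  k<m⇒dependent {zero} {suc m} _ v = record
    { coeff = λ _ → 1ℚ ; support = zero ; coeff≢0 = λ () ; vanishes = λ () }
  k<m⇒dependent {suc k} {suc m} k<m v with Finₚ.any? (λ l → ¬? (v l zero ℚₚ.≟ 0ℚ))
  ... | yes (p , vp≢0) = fromEliminated v p {{ℚ.≢-nonZero vp≢0}}
                           (k<m⇒dependent (ℕ.s<s⁻¹ k<m) (eliminate v p {{ℚ.≢-nonZero vp≢0}}))
  ... | no noPivot     = addZeroCoordinate v
                           (λ l → decidable-stable (v l zero ℚₚ.≟ 0ℚ) (noPivot ∘ (l ,_)))
                           (k<m⇒dependent (ℕₚ.<⇒≤ k<m) _)

  -- Affine dimension

  _+ᴹ_ : ∀ {n} → Matrix n → Matrix n → Matrix n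
  (A +ᴹ B) i j = A i j + B i j

  _·ᴹ_ : ∀ {n} → ℚ → Matrix n → Matrix n
  (x ·ᴹ A) i j = x * A i j

  combination : ∀ {m n} → (Fin m → ℚ) → (Fin m → Matrix n) → Matrix n
  combination c P i j = ∑ (λ l → c l * P l i j)

  LinearlyIndependent : ∀ {n D} → (Fin D → Matrix n) → Set
  LinearlyIndependent E = ∀ c → (∀ i j → combination c E i j ≡ 0ℚ) → ∀ t → c t ≡ 0ℚ

  linearlyIndependent-· : ∀ {n D} {ε} {E : Fin D → Matrix n} → ε ≢ 0ℚ →
                          LinearlyIndependent E → LinearlyIndependent (λ t → ε ·ᴹ E t)
  linearlyIndependent-· {ε = ε} {E} ε≢0 indep c comb≡0 t =
    x*y≡0⇒x≡0 (c t) ε≢0 (indep (λ t → c t * ε) cε-comb≡0 t)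
    where
    cε-comb≡0 : ∀ i j → combination (λ t → c t * ε) E i j ≡ 0ℚ
    cε-comb≡0 i j = trans (∑-cong λ t → ℚₚ.*-assoc (c t) ε (E t i j)) (comb≡0 i j)

  isolate-coefficient : ∀ {D} {I : Set} (e : Fin D ↔ I) (c : Fin D → ℚ) (x : I → ℚ) s →
                        let open Inverse e in
                        ∑ (λ t → c t * x (to t)) ≡ 0ℚ → x s ≢ 0ℚ →
                        (∀ i → i ≢ s → c (from i) * x i ≡ 0ℚ) → c (from s) ≡ 0ℚ
  isolate-coefficient e c x s ∑≡0 xs≢0 others = x*y≡0⇒x≡0 (c (from s))
    (xs≢0 ∘ subst (λ i → x i ≡ 0ℚ) (strictlyInverseˡ s))
    (trans (sym (∑-single (from s) (λ t → c t * x (to t)) others′)) ∑≡0)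
    where
    open Inverse e
    others′ : ∀ t → t ≢ from s → c t * x (to t) ≡ 0ℚ
    others′ t t≢s = subst (λ t′ → c t′ * x (to t) ≡ 0ℚ) (strictlyInverseʳ t)
      (others (to t) (λ to-t≡s → t≢s (trans (sym (strictlyInverseʳ t)) (cong from to-t≡s))))

  -- The affine dimension of S is at most the number of coordinates needed to determine the
  -- elements of a space T containing the direction space of S.
  ¬HasAffIndep-of-coordinates :
    ∀ {n D} (S T : Matrix n → Set) (q : Fin D → Fin n × Fin n) →
    (∀ {m} (P : Fin m → Matrix n) c → (∀ l → S (P l)) → ∑ c ≡ 0ℚ → T (combination c P)) →
    (∀ M → T M → (∀ t → uncurry M (q t) ≡ 0ℚ) → ∀ i j → M i j ≡ 0ℚ) →
    ¬ HasAffIndep S (suc (suc D))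
  ¬HasAffIndep-of-coordinates {D = D} S T q diff∈T determined (P , P∈S , indep) =
    coeff≢0 (indep coeff ∑coeff≡0 comb≡0 support)
    where
    -- The leading coordinate 1 turns a linear relation among the v l into an affine one.
    v : Fin (suc (suc D)) → Fin (suc D) → ℚ
    v l zero    = 1ℚ
    v l (suc t) = uncurry (P l) (q t)
    open NontrivialRelation (k<m⇒dependent ℕₚ.≤-refl v)
    ∑coeff≡0 : ∑ coeff ≡ 0ℚ
    ∑coeff≡0 = trans (∑-cong λ l → sym (ℚₚ.*-identityʳ (coeff l))) (vanishes zero)
    comb≡0 : ∀ i j → combination coeff P i j ≡ 0ℚ
    comb≡0 = determined _ (diff∈T P coeff P∈S ∑coeff≡0) (vanishes ∘ suc)

  baseAndOffsets : ∀ {n D} → Matrix n → (Fin D → Matrix n) → Fin (suc D) → Matrix n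
  baseAndOffsets B E zero    = B
  baseAndOffsets B E (suc t) = B +ᴹ E t

  combination-baseAndOffsets :
    ∀ {n D} (B : Matrix n) (E : Fin D → Matrix n) c i j →
    combination c (baseAndOffsets B E) i j ≡ ∑ c * B i j + combination (c ∘ suc) E i j
  combination-baseAndOffsets B E c i j = begin
    c zero * B i j + ∑ (λ t → c′ t * (B i j + E t i j))
      ≡⟨ cong (c zero * B i j +_) (trans (∑-cong λ t → ℚₚ.*-distribˡ-+ (c′ t) (B i j) (E t i j))
                                         (∑-distrib-+ (λ t → c′ t * B i j) (λ t → c′ t * E t i j))) ⟩
    c zero * B i j + (∑ (λ t → c′ t * B i j) + combination c′ E i j)
      ≡⟨ cong (λ x → c zero * B i j + (x + combination c′ E i j)) (*-distribʳ-∑ (B i j) c′) ⟨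
    c zero * B i j + (∑ c′ * B i j + combination c′ E i j)
      ≡⟨ solve 4 (λ a b s x → a :* b :+ (s :* b :+ x) := (a :+ s) :* b :+ x) refl
                 (c zero) (B i j) (∑ c′) (combination c′ E i j) ⟩
    ∑ c * B i j + combination c′ E i j ∎
    where
    open ≡-Reasoning
    open +-*-Solver
    c′ = c ∘ suc

  HasAffIndep-of-offsets :
    ∀ {n D} (S : Matrix n → Set) (B : Matrix n) (E : Fin D → Matrix n) →
    S B → (∀ t → S (B +ᴹ E t)) → LinearlyIndependent E → HasAffIndep S (suc D)
  HasAffIndep-of-offsets S B E B∈S B+E∈S indep = baseAndOffsets B E , P∈S , affIndep
    where
    P∈S : ∀ l → S (baseAndOffsets B E l)
    P∈S zero    = B∈S
    P∈S (suc t) = B+E∈S t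
    affIndep : AffinelyIndependent (baseAndOffsets B E)
    affIndep c ∑c≡0 comb≡0 = c≡0
      where
      open ≡-Reasoning
      c′ = c ∘ suc
      c′≡0 : ∀ t → c′ t ≡ 0ℚ
      c′≡0 = indep c′ λ i j → begin
        combination c′ E i j                          ≡⟨ ℚₚ.+-identityˡ _ ⟨
        0ℚ + combination c′ E i j                     ≡⟨ cong (_+ combination c′ E i j)
                                                           (x≡0⇒x*y≡0 (B i j) ∑c≡0) ⟨
        ∑ c * B i j + combination c′ E i j            ≡⟨ combination-baseAndOffsets B E c i j ⟨
        combination c (baseAndOffsets B E) i j        ≡⟨ comb≡0 i j ⟩
        0ℚ                                            ∎
      c≡0 : ∀ l → c l ≡ 0ℚ
      c≡0 (suc t) = c′≡0 t
      c≡0 zero    = begin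
        c zero          ≡⟨ ℚₚ.+-identityʳ (c zero) ⟨
        c zero + 0ℚ     ≡⟨ cong (c zero +_) (∑-zero c′≡0) ⟨
        ∑ c             ≡⟨ ∑c≡0 ⟩
        0ℚ              ∎

  -- The tangent space of Ωπ

  record LineSumsZero {n} (M : Matrix n) : Set where
    field
      rowSum≡0 : ∀ i → ∑ (M i) ≡ 0ℚ
      colSum≡0 : ∀ j → ∑ (λ i → M i j) ≡ 0ℚ

  Tangent : ∀ {n} → Matrix n → Set
  Tangent M = Centrosymmetric M × LineSumsZero M

  centrosymmetric-opposite : ∀ {n} {M : Matrix n} → Centrosymmetric M →
                             ∀ i j → M (opposite i) j ≡ M i (opposite j)
  centrosymmetric-opposite {M = M} M-cs i j =
    trans (cong (M (opposite i)) (sym (Finₚ.opposite-involutive j))) (M-cs i (opposite j))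

  combination-tangent : ∀ {m n} (P : Fin m → Matrix n) c →
                        (∀ l → Ωπ n (P l)) → ∑ c ≡ 0ℚ → Tangent (combination c P)
  combination-tangent P c P∈Ω ∑c≡0 =
    (λ i j → ∑-cong λ l → cong (c l *_) (proj₁ (P∈Ω l) i j)) ,
    record { rowSum≡0 = λ i → lineSum (λ l → P l i) (λ l → proj₁ (proj₂ (proj₂ (P∈Ω l))) i)
           ; colSum≡0 = λ j → lineSum (λ l i → P l i j) (λ l → proj₂ (proj₂ (proj₂ (P∈Ω l))) j)
           }
    where
    lineSum : ∀ {k} (L : _ → Fin k → ℚ) → (∀ l → ∑ (L l) ≡ 1ℚ) →
              ∑ (λ j → ∑ (λ l → c l * L l j)) ≡ 0ℚ
    lineSum L ∑L≡1 = begin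
      ∑ (λ j → ∑ (λ l → c l * L l j)) ≡⟨ ∑-comm (λ l j → c l * L l j) ⟨
      ∑ (λ l → ∑ (λ j → c l * L l j)) ≡⟨ ∑-cong (λ l → sym (*-distribˡ-∑ (c l) (L l))) ⟩
      ∑ (λ l → c l * ∑ (L l))         ≡⟨ ∑-cong (λ l → trans (cong (c l *_) (∑L≡1 l))
                                                              (ℚₚ.*-identityʳ (c l))) ⟩
      ∑ c                             ≡⟨ ∑c≡0 ⟩
      0ℚ                              ∎
      where open ≡-Reasoning

  Ωπ-+ᴹ : ∀ {n} {B E : Matrix n} → Ωπ n B → Tangent E →
          (∀ i j → 0ℚ ≤ B i j + E i j) → Ωπ n (B +ᴹ E)
  Ωπ-+ᴹ {B = B} {E} (B-cs , _ , B-rows , B-cols) (E-cs , E-sums) B+E≥0 =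
    (λ i j → cong₂ _+_ (B-cs i j) (E-cs i j)) , B+E≥0 ,
    (λ i → lineSum (B i) (E i) (B-rows i) (rowSum≡0 i)) ,
    (λ j → lineSum (λ i → B i j) (λ i → E i j) (B-cols j) (colSum≡0 j))
    where
    open LineSumsZero E-sums
    lineSum : ∀ {k} (b e : Fin k → ℚ) → ∑ b ≡ 1ℚ → ∑ e ≡ 0ℚ → ∑ (λ j → b j + e j) ≡ 1ℚ
    lineSum b e ∑b≡1 ∑e≡0 =
      trans (∑-distrib-+ b e) (trans (cong₂ _+_ ∑b≡1 ∑e≡0) (ℚₚ.+-identityʳ 1ℚ))

  tangent-· : ∀ {n} x {E : Matrix n} → Tangent E → Tangent (x ·ᴹ E)
  tangent-· x {E} (E-cs , E-sums) =
    (λ i j → cong (x *_) (E-cs i j)) ,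
    record { rowSum≡0 = λ i → scaled (E i) (rowSum≡0 i)
           ; colSum≡0 = λ j → scaled (λ i → E i j) (colSum≡0 j)
           }
    where
    open LineSumsZero E-sums
    scaled : ∀ {k} (e : Fin k → ℚ) → ∑ e ≡ 0ℚ → ∑ (λ j → x * e j) ≡ 0ℚ
    scaled e ∑e≡0 = trans (sym (*-distribˡ-∑ x e)) (y≡0⇒x*y≡0 x ∑e≡0)

  -- Exchange matrices

  opposite-injective : ∀ {n} {x y : Fin n} → opposite x ≡ opposite y → x ≡ y
  opposite-injective {x = x} {y} eq =
    trans (sym (Finₚ.opposite-involutive x)) (trans (cong opposite eq) (Finₚ.opposite-involutive y))

  data Sign : ℚ → Set where
    minus : Sign (- 1ℚ)
    nil   : Sign 0ℚ
    plus  : Sign 1ℚ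

  sign-* : ∀ {p q} → Sign p → Sign q → Sign (p * q)
  sign-* minus minus = plus
  sign-* minus nil   = nil
  sign-* minus plus  = minus
  sign-* nil   minus = nil
  sign-* nil   nil   = nil
  sign-* nil   plus  = nil
  sign-* plus  minus = minus
  sign-* plus  nil   = nil
  sign-* plus  plus  = plus

  sign-≥-1 : ∀ {p} → Sign p → 0ℚ ≤ 1ℚ + p
  sign-≥-1 minus = ℚₚ.≤-refl
  sign-≥-1 nil   = ℚₚ.nonNegative⁻¹ 1ℚ
  sign-≥-1 plus  = ℚₚ.nonNegative⁻¹ (1ℚ + 1ℚ)

  -- δ is opaque so that unification treats δ x i as rigid; it is used only through the
  -- lemmas of this block.
  opaque
    δ : ∀ {n} → Fin n → Fin n → ℚ
    δ x i with x Finₚ.≟ i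
    ... | yes _ = 1ℚ
    ... | no  _ = 0ℚ

    δ-refl : ∀ {n} (x : Fin n) → δ x x ≡ 1ℚ
    δ-refl x with x Finₚ.≟ x
    ... | yes _   = refl
    ... | no  x≢x = contradiction refl x≢x

    δ-≢ : ∀ {n} {x i : Fin n} → x ≢ i → δ x i ≡ 0ℚ
    δ-≢ {x = x} {i} x≢i with x Finₚ.≟ i
    ... | yes x≡i = contradiction x≡i x≢i
    ... | no  _   = refl

    δ-opposite : ∀ {n} (x i : Fin n) → δ (opposite x) (opposite i) ≡ δ x i
    δ-opposite x i with x Finₚ.≟ i
    ... | yes refl = δ-refl (opposite x)
    ... | no  x≢i  = δ-≢ (x≢i ∘ opposite-injective)

    sign-δ-δ : ∀ {n} (x x′ i : Fin n) → Sign (δ x i - δ x′ i)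
    sign-δ-δ x x′ i with x Finₚ.≟ i | x′ Finₚ.≟ i
    ... | yes _ | yes _ = nil
    ... | yes _ | no  _ = plus
    ... | no  _ | yes _ = minus
    ... | no  _ | no  _ = nil

  δ-oppositeʳ : ∀ {n} (x i : Fin n) → δ x (opposite i) ≡ δ (opposite x) i
  δ-oppositeʳ x i = begin
    δ x (opposite i)
      ≡⟨ cong (λ y → δ y (opposite i)) (Finₚ.opposite-involutive x) ⟨
    δ (opposite (opposite x)) (opposite i)
      ≡⟨ δ-opposite (opposite x) i ⟩
    δ (opposite x) i ∎
    where open ≡-Reasoning

  ∑-δ : ∀ {n} (x : Fin n) → ∑ (δ x) ≡ 1ℚ
  ∑-δ x = trans (∑-single x (δ x) (λ i i≢x → δ-≢ (i≢x ∘ sym))) (δ-refl x)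

  e[_-_] : ∀ {n} → Fin n → Fin n → Fin n → ℚ
  e[ x - x′ ] i = δ x i - δ x′ i

  ∑-e : ∀ {n} (x x′ : Fin n) → ∑ e[ x - x′ ] ≡ 0ℚ
  ∑-e x x′ = trans (∑-distrib-minus (δ x) (δ x′)) (cong₂ _-_ (∑-δ x) (∑-δ x′))

  exchange : ∀ {n} (x x′ y y′ : Fin n) → Matrix n
  exchange x x′ y y′ i j = e[ x - x′ ] i * e[ y - y′ ] j

  exchange-lineSumsZero : ∀ {n} (x x′ y y′ : Fin n) → LineSumsZero (exchange x x′ y y′)
  exchange-lineSumsZero x x′ y y′ = record
    { rowSum≡0 = λ i → trans (sym (*-distribˡ-∑ (e[ x - x′ ] i) e[ y - y′ ]))
                             (y≡0⇒x*y≡0 (e[ x - x′ ] i) (∑-e y y′))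
    ; colSum≡0 = λ j → trans (sym (*-distribʳ-∑ (e[ y - y′ ] j) e[ x - x′ ]))
                             (x≡0⇒x*y≡0 (e[ y - y′ ] j) (∑-e x x′))
    }

  exchange-π : ∀ {n} (x x′ y y′ i j : Fin n) →
               (exchange x x′ y y′ ^π) i j ≡
               exchange (opposite x) (opposite x′) (opposite y) (opposite y′) i j
  exchange-π x x′ y y′ i j = cong₂ _*_ (cong₂ _-_ (δ-oppositeʳ x i) (δ-oppositeʳ x′ i))
                                       (cong₂ _-_ (δ-oppositeʳ y j) (δ-oppositeʳ y′ j))

  exchange-at : ∀ {n} {x x′ y y′ i j : Fin n} → δ x′ i ≡ 0ℚ → δ y′ j ≡ 0ℚ →
                exchange x x′ y y′ i j ≡ δ x i * δ y j
  exchange-at {x = x} {x′} {y} {y′} {i} {j} δx′i≡0 δy′j≡0 rewrite δx′i≡0 | δy′j≡0 =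
    cong₂ _*_ (ℚₚ.+-identityʳ (δ x i)) (ℚₚ.+-identityʳ (δ y j))

  exchange-row≡0 : ∀ {n} {x x′ y y′ i j : Fin n} → δ x i ≡ 0ℚ → δ x′ i ≡ 0ℚ →
                   exchange x x′ y y′ i j ≡ 0ℚ
  exchange-row≡0 {y = y} {y′} {j = j} δxi≡0 δx′i≡0 rewrite δxi≡0 | δx′i≡0 = ℚₚ.*-zeroˡ (e[ y - y′ ] j)

  exchange-swap : ∀ {n} (x x′ y y′ i j : Fin n) →
                  exchange x x′ y y′ i j ≡ exchange x′ x y′ y i j
  exchange-swap x x′ y y′ i j = solve 4 (λ a b c d → (a :- b) :* (c :- d) := (b :- a) :* (d :- c))
                                        refl (δ x i) (δ x′ i) (δ y j) (δ y′ j)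
    where open +-*-Solver

  centrosymmetrize : ∀ {n} → Matrix n → Matrix n
  centrosymmetrize A = A +ᴹ (A ^π)

  centrosymmetrize-centrosymmetric : ∀ {n} (A : Matrix n) → Centrosymmetric (centrosymmetrize A)
  centrosymmetrize-centrosymmetric A i j = begin
    A (opposite i) (opposite j) + A (opposite (opposite i)) (opposite (opposite j))
      ≡⟨ cong (A (opposite i) (opposite j) +_)
              (cong₂ A (Finₚ.opposite-involutive i) (Finₚ.opposite-involutive j)) ⟩
    A (opposite i) (opposite j) + A i j
      ≡⟨ ℚₚ.+-comm (A (opposite i) (opposite j)) (A i j) ⟩
    A i j + A (opposite i) (opposite j) ∎
    where open ≡-Reasoning

  two : ℚ
  two = 1ℚ + 1ℚ

  centrosymmetrize-exchange-tangent : ∀ {n} (x x′ y y′ : Fin n) →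
                                    Tangent (centrosymmetrize (exchange x x′ y y′))
  centrosymmetrize-exchange-tangent x x′ y y′ = centrosymmetrize-centrosymmetric A , record
    { rowSum≡0 = λ i → lineSum (∑-distrib-+ (A i) (Aπ i)) (rowSum≡0 A-sums i)
                               (trans (∑-cong (exchange-π x x′ y y′ i)) (rowSum≡0 Aπ-sums i))
    ; colSum≡0 = λ j → lineSum (∑-distrib-+ (λ i → A i j) (λ i → Aπ i j)) (colSum≡0 A-sums j)
                               (trans (∑-cong λ i → exchange-π x x′ y y′ i j) (colSum≡0 Aπ-sums j))
    }
    where
    open LineSumsZero
    A = exchange x x′ y y′
    Aπ = A ^π
    A-sums = exchange-lineSumsZero x x′ y y′
    Aπ-sums = exchange-lineSumsZero (opposite x) (opposite x′) (opposite y) (opposite y′)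
    lineSum : ∀ {s a b} → s ≡ a + b → a ≡ 0ℚ → b ≡ 0ℚ → s ≡ 0ℚ
    lineSum s≡a+b refl refl = s≡a+b

  centrosymmetrize-exchange-≥-2 : ∀ {n} (x x′ y y′ i j : Fin n) →
                                  0ℚ ≤ two + centrosymmetrize (exchange x x′ y y′) i j
  centrosymmetrize-exchange-≥-2 x x′ y y′ i j = subst (0ℚ ≤_)
    (interchange 1ℚ (A i j) 1ℚ (A (opposite i) (opposite j)))
    (ℚₚ.+-mono-≤ (bound i j) (bound (opposite i) (opposite j)))
    where
    A = exchange x x′ y y′
    bound : ∀ i j → 0ℚ ≤ 1ℚ + A i j
    bound i j = sign-≥-1 (sign-* (sign-δ-δ x x′ i) (sign-δ-δ y y′ j))

  module Halves (m : ℕ) where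

    top : Fin m → Fin (m ℕ.+ m)
    top i = i ↑ˡ m

    opposite-top : ∀ i → opposite (top i) ≡ m ↑ʳ opposite i
    opposite-top i = Finₚ.toℕ-injective (begin
      toℕ (opposite (i ↑ˡ m))       ≡⟨ Finₚ.opposite-prop (i ↑ˡ m) ⟩
      m ℕ.+ m ∸ suc (toℕ (i ↑ˡ m))  ≡⟨ cong (λ t → m ℕ.+ m ∸ suc t) (Finₚ.toℕ-↑ˡ i m) ⟩
      m ℕ.+ m ∸ suc (toℕ i)         ≡⟨ ℕₚ.+-∸-assoc m (Finₚ.toℕ<n i) ⟩
      m ℕ.+ (m ∸ suc (toℕ i))       ≡⟨ cong (m ℕ.+_) (Finₚ.opposite-prop i) ⟨
      m ℕ.+ toℕ (opposite i)        ≡⟨ Finₚ.toℕ-↑ʳ m (opposite i) ⟨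
      toℕ (m ↑ʳ opposite i)         ∎)
      where open ≡-Reasoning

    top≢opposite-top : ∀ i j → top i ≢ opposite (top j)
    top≢opposite-top i j eq with
      trans (sym (Finₚ.splitAt-↑ˡ m i m)) (trans (cong (splitAt m) (trans eq (opposite-top j)))
                                                   (Finₚ.splitAt-↑ʳ m m (opposite j)))
    ... | ()

    data Half : Fin (m ℕ.+ m) → Set where
      upper : ∀ i → Half (top i)
      lower : ∀ i → Half (opposite (top i))

    half : ∀ i → Half i
    half i with splitAt m i in eq
    ... | inj₁ t = subst Half (Finₚ.splitAt⁻¹-↑ˡ eq) (upper t)
    ... | inj₂ t = subst Half bottom (lower (opposite t))
      where
      bottom : opposite (top (opposite t)) ≡ i
      bottom = trans (opposite-top (opposite t))
                     (trans (cong (m ↑ʳ_) (Finₚ.opposite-involutive t)) (Finₚ.splitAt⁻¹-↑ʳ eq))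

  -- Centrosymmetric doubly stochastic matrices of order 2m, for m = suc k

  module EvenOrder (k : ℕ) where

    m n D : ℕ
    m = suc k
    n = m ℕ.+ m
    D = k ℕ.* (k ℕ.+ m) ℕ.+ m

    open Halves m

    Free : Set
    Free = (Fin k × Fin (k ℕ.+ m)) ⊎ Fin m

    pattern inner a b = inj₁ (a , b)
    pattern pivot j   = inj₂ j

    opaque
      enumeration : Fin D ↔ Free
      enumeration = ↔-trans Finₚ.+↔⊎ (Finₚ.*↔× ⊎-↔ ↔-refl)

    open Inverse enumeration using (to; from; strictlyInverseˡ; strictlyInverseʳ)

    position : Free → Fin n × Fin n
    position (inner a b) = top (suc a) , suc b
    position (pivot j)   = zero , top j

    coordinate : Free → Matrix n → ℚ
    coordinate f M = uncurry M (position f)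

    module _ (M : Matrix n) (M-cs : Centrosymmetric M) (M-sums : LineSumsZero M)
             (coordinates≡0 : ∀ f → coordinate f M ≡ 0ℚ) where

      open LineSumsZero M-sums
      open ≡-Reasoning

      innerRow≡0 : ∀ a j → M (top (suc a)) j ≡ 0ℚ
      innerRow≡0 a (suc b) = coordinates≡0 (inner a b)
      innerRow≡0 a zero    = begin
        M r zero        ≡⟨ ℚₚ.+-identityʳ (M r zero) ⟨
        M r zero + 0ℚ   ≡⟨ cong (M r zero +_) (∑-zero (λ b → coordinates≡0 (inner a b))) ⟨
        ∑ (M r)         ≡⟨ rowSum≡0 r ⟩
        0ℚ              ∎
        where r = top (suc a)

      offPivotRow≡0 : ∀ i j → i ≢ zero → i ≢ opposite zero → M i j ≡ 0ℚ
      offPivotRow≡0 i j i≢first i≢last with half i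
      ... | upper zero    = contradiction refl i≢first
      ... | upper (suc a) = innerRow≡0 a j
      ... | lower zero    = contradiction refl i≢last
      ... | lower (suc a) =
        trans (centrosymmetric-opposite M-cs (top (suc a)) j) (innerRow≡0 a (opposite j))

      pivotRow-antisymmetric : ∀ j → M zero j + M zero (opposite j) ≡ 0ℚ
      pivotRow-antisymmetric j = begin
        M zero j + M zero (opposite j)  ≡⟨ cong (M zero j +_) (centrosymmetric-opposite M-cs zero j) ⟨
        M zero j + M (opposite zero) j  ≡⟨ ∑-pair (λ i → M i j) (top≢opposite-top zero zero)
                                                  (λ i → offPivotRow≡0 i j) ⟨
        ∑ (λ i → M i j)                 ≡⟨ colSum≡0 j ⟩
        0ℚ                              ∎

      pivotRow≡0 : ∀ j → M zero j ≡ 0ℚ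
      pivotRow≡0 j with half j
      ... | upper t = coordinates≡0 (pivot t)
      ... | lower t = begin
        M zero (opposite (top t))                   ≡⟨ ℚₚ.+-identityˡ _ ⟨
        0ℚ + M zero (opposite (top t))              ≡⟨ cong (_+ M zero (opposite (top t)))
                                                            (coordinates≡0 (pivot t)) ⟨
        M zero (top t) + M zero (opposite (top t))  ≡⟨ pivotRow-antisymmetric (top t) ⟩
        0ℚ                                          ∎

      tangent≡0 : ∀ i j → M i j ≡ 0ℚ
      tangent≡0 i j with i Finₚ.≟ zero | i Finₚ.≟ opposite zero
      ... | yes refl   | _         = pivotRow≡0 j
      ... | no _       | yes refl  =
        trans (centrosymmetric-opposite M-cs zero j) (pivotRow≡0 (opposite j))
      ... | no i≢first | no i≢last = offPivotRow≡0 i j i≢first i≢last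

    direction : Free → Matrix n
    direction (inner a b) = centrosymmetrize (exchange (top (suc a)) zero (suc b) zero)
    direction (pivot j)   = centrosymmetrize (exchange zero (opposite zero) (top j) (opposite (top j)))

    direction-tangent : ∀ f → Tangent (direction f)
    direction-tangent (inner a b) = centrosymmetrize-exchange-tangent (top (suc a)) zero (suc b) zero
    direction-tangent (pivot j)   =
      centrosymmetrize-exchange-tangent zero (opposite zero) (top j) (opposite (top j))

    direction-≥-2 : ∀ f i j → 0ℚ ≤ two + direction f i j
    direction-≥-2 (inner a b) = centrosymmetrize-exchange-≥-2 (top (suc a)) zero (suc b) zero
    direction-≥-2 (pivot j)   =
      centrosymmetrize-exchange-≥-2 zero (opposite zero) (top j) (opposite (top j))

    δ-top-bottom : ∀ i j → δ (top i) (opposite (top j)) ≡ 0ℚ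
    δ-top-bottom i j = δ-≢ (top≢opposite-top i j)

    δ-bottom-top : ∀ i j → δ (opposite (top i)) (top j) ≡ 0ℚ
    δ-bottom-top i j = δ-≢ (top≢opposite-top j i ∘ sym)

    inner-at-inner : ∀ a b a′ b′ → coordinate (inner a b) (direction (inner a′ b′)) ≡
                                   δ (top (suc a′)) (top (suc a)) * δ (suc b′) (suc b)
    inner-at-inner a b a′ b′ =
      trans (cong₂ _+_ (exchange-at (δ-≢ (λ ())) (δ-≢ (λ ())))
                       (exchange-row≡0 (δ-top-bottom (suc a′) (suc a)) (δ-top-bottom zero (suc a))))
            (ℚₚ.+-identityʳ _)

    inner-at-inner-≡ : ∀ a b → coordinate (inner a b) (direction (inner a b)) ≡ 1ℚ
    inner-at-inner-≡ a b = trans (inner-at-inner a b a b)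
                                 (cong₂ _*_ (δ-refl (top (suc a))) (δ-refl {n} (suc b)))

    inner-at-inner-≢ : ∀ {a a′ : Fin k} {b b′ : Fin (k ℕ.+ m)} → (a′ , b′) ≢ (a , b) →
                       coordinate (inner a b) (direction (inner a′ b′)) ≡ 0ℚ
    inner-at-inner-≢ {a} {a′} {b} {b′} ab≢ with a′ Finₚ.≟ a
    ... | yes refl = trans (inner-at-inner a b a b′)
                           (y≡0⇒x*y≡0 (δ (top (suc a)) (top (suc a)))
                                      (δ-≢ (ab≢ ∘ cong (a ,_) ∘ Finₚ.suc-injective)))
    ... | no a′≢a  = trans (inner-at-inner a b a′ b′)
                           (x≡0⇒x*y≡0 (δ (suc b′) (suc b))
                                      (δ-≢ (a′≢a ∘ Finₚ.suc-injective ∘ Finₚ.↑ˡ-injective m _ _)))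

    pivot-at-inner : ∀ a b j → coordinate (inner a b) (direction (pivot j)) ≡ 0ℚ
    pivot-at-inner a b j =
      cong₂ _+_ (exchange-row≡0 (δ-≢ (λ ())) (δ-bottom-top zero (suc a)))
                (exchange-row≡0 (δ-top-bottom zero (suc a))
                                (trans (δ-opposite zero (top (suc a))) (δ-≢ (λ ()))))

    pivot-at-pivot : ∀ j j′ → coordinate (pivot j) (direction (pivot j′)) ≡
                              δ (top j′) (top j) + δ (top j′) (top j)
    pivot-at-pivot j j′ = cong₂ _+_
      (trans (exchange-at (δ-bottom-top zero zero) (δ-bottom-top j′ j)) (one-times (δ-refl zero)))
      (begin
        exchange zero zero′ (top j′) (opposite (top j′)) zero′ (opposite (top j))
          ≡⟨ exchange-swap zero zero′ (top j′) (opposite (top j′)) zero′ (opposite (top j)) ⟩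
        exchange zero′ zero (opposite (top j′)) (top j′) zero′ (opposite (top j))
          ≡⟨ exchange-at (δ-top-bottom zero zero) (δ-top-bottom j′ j) ⟩
        δ zero′ zero′ * δ (opposite (top j′)) (opposite (top j))
          ≡⟨ one-times (trans (δ-opposite zero zero) (δ-refl zero)) ⟩
        δ (opposite (top j′)) (opposite (top j))
          ≡⟨ δ-opposite (top j′) (top j) ⟩
        δ (top j′) (top j) ∎)
      where
      open ≡-Reasoning
      zero′ : Fin n
      zero′ = opposite zero
      one-times : ∀ {a b} → a ≡ 1ℚ → a * b ≡ b
      one-times {b = b} refl = ℚₚ.*-identityˡ b

    pivot-at-pivot-≡ : ∀ j → coordinate (pivot j) (direction (pivot j)) ≡ two
    pivot-at-pivot-≡ j = trans (pivot-at-pivot j j) (cong (λ d → d + d) (δ-refl (top j)))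

    pivot-at-pivot-≢ : ∀ {j j′ : Fin m} → j′ ≢ j →
                       coordinate (pivot j) (direction (pivot j′)) ≡ 0ℚ
    pivot-at-pivot-≢ {j} {j′} j′≢j =
      trans (pivot-at-pivot j j′) (cong (λ d → d + d) (δ-≢ (j′≢j ∘ Finₚ.↑ˡ-injective m _ _)))

    module _ (c : Fin D → ℚ) (comb≡0 : ∀ i j → combination c (direction ∘ to) i j ≡ 0ℚ) where

      isolate : ∀ f → coordinate f (direction f) ≢ 0ℚ →
                (∀ g → g ≢ f → c (from g) * coordinate f (direction g) ≡ 0ℚ) → c (from f) ≡ 0ℚ
      isolate f = isolate-coefficient enumeration c (λ g → coordinate f (direction g)) f
                                      (uncurry comb≡0 (position f))

      inner-coefficient≡0 : ∀ a b → c (from (inner a b)) ≡ 0ℚ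
      inner-coefficient≡0 a b =
        isolate (inner a b) (ℚₚ.1≢0 ∘ trans (sym (inner-at-inner-≡ a b))) others
        where
        others : ∀ g → g ≢ inner a b → c (from g) * coordinate (inner a b) (direction g) ≡ 0ℚ
        others (inner a′ b′) g≢f =
          y≡0⇒x*y≡0 (c (from (inner a′ b′))) (inner-at-inner-≢ (g≢f ∘ cong inj₁))
        others (pivot j)     _   = y≡0⇒x*y≡0 (c (from (pivot j))) (pivot-at-inner a b j)

      pivot-coefficient≡0 : ∀ j → c (from (pivot j)) ≡ 0ℚ
      pivot-coefficient≡0 j = isolate (pivot j) ((λ ()) ∘ trans (sym (pivot-at-pivot-≡ j))) others
        where
        others : ∀ g → g ≢ pivot j → c (from g) * coordinate (pivot j) (direction g) ≡ 0ℚ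
        others (inner a b) _   = x≡0⇒x*y≡0 (coordinate (pivot j) (direction (inner a b)))
                                           (inner-coefficient≡0 a b)
        others (pivot j′)  g≢f =
          y≡0⇒x*y≡0 (c (from (pivot j′))) (pivot-at-pivot-≢ (g≢f ∘ cong inj₂))

    directions-independent : LinearlyIndependent (direction ∘ to)
    directions-independent c comb≡0 t =
      trans (cong c (sym (strictlyInverseʳ t))) (coefficient≡0 (to t))
      where
      coefficient≡0 : ∀ f → c (from f) ≡ 0ℚ
      coefficient≡0 (inner a b) = inner-coefficient≡0 c comb≡0 a b
      coefficient≡0 (pivot j)   = pivot-coefficient≡0 c comb≡0 j

    N : ℚ
    N = n ×ₙ 1ℚ

    instance
      N+N-positive : Positive (N + N)
      N+N-positive = ℚₚ.pos+pos⇒pos N {{N-positive}} N {{N-positive}}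
        where N-positive = suc×ₙ1-positive (k ℕ.+ m)

      N+N-nonZero : NonZero (N + N)
      N+N-nonZero = ℚₚ.pos⇒nonZero (N + N)

    -- The uniform matrix has entries 2ε and every direction has entries ≥ -2.
    ε : ℚ
    ε = 1/ (N + N)

    instance
      ε-positive : Positive ε
      ε-positive = ℚₚ.1/pos⇒pos (N + N)

      ε-nonNegative : ℚ.NonNegative ε
      ε-nonNegative = ℚₚ.pos⇒nonNeg ε

    ε≢0 : ε ≢ 0ℚ
    ε≢0 ε≡0 = ℚₚ.<-irrefl (sym ε≡0) (ℚₚ.positive⁻¹ ε)

    uniform : Matrix n
    uniform _ _ = ε + ε

    ∑-uniform : ∑ {n} (λ _ → ε + ε) ≡ 1ℚ
    ∑-uniform = begin
      ∑ {n} (λ _ → ε + ε)   ≡⟨ ∑-replicate {n} (ε + ε) ⟩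
      N * (ε + ε)           ≡⟨ solve 2 (λ N ε → N :* (ε :+ ε) := (N :+ N) :* ε) refl N ε ⟩
      (N + N) * ε           ≡⟨ ℚₚ.*-inverseʳ (N + N) ⟩
      1ℚ                    ∎
      where
      open ≡-Reasoning
      open +-*-Solver

    uniform-Ωπ : Ωπ n uniform
    uniform-Ωπ =
      (λ _ _ → refl) , (λ _ _ → ℚₚ.+-mono-≤ ε≥0 ε≥0) , (λ _ → ∑-uniform) , (λ _ → ∑-uniform)
      where ε≥0 = ℚₚ.nonNegative⁻¹ ε

    perturbed-Ωπ : ∀ f → Ωπ n (uniform +ᴹ (ε ·ᴹ direction f))
    perturbed-Ωπ f = Ωπ-+ᴹ uniform-Ωπ (tangent-· ε (direction-tangent f)) entry≥0
      where
      open +-*-Solver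
      entry≥0 : ∀ i j → 0ℚ ≤ (ε + ε) + ε * direction f i j
      entry≥0 i j = subst₂ _≤_ (ℚₚ.*-zeroʳ ε)
        (solve 2 (λ ε d → ε :* ((con 1ℚ :+ con 1ℚ) :+ d) := (ε :+ ε) :+ ε :* d)
                 refl ε (direction f i j))
        (ℚₚ.*-monoˡ-≤-nonNeg ε (direction-≥-2 f i j))

    dimension : AffDim (Ωπ n) D
    dimension =
      HasAffIndep-of-offsets (Ωπ n) uniform (λ t → ε ·ᴹ direction (to t))
        uniform-Ωπ (perturbed-Ωπ ∘ to) (linearlyIndependent-· ε≢0 directions-independent) ,
      ¬HasAffIndep-of-coordinates (Ωπ n) Tangent (position ∘ to) combination-tangent
        λ M (M-cs , M-sums) coordinates≡0 → tangent≡0 M M-cs M-sums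
          (λ f → subst (λ g → coordinate g M ≡ 0ℚ) (strictlyInverseˡ f) (coordinates≡0 (from f)))

  dimension-formula : ∀ k → ((suc k ℕ.+ suc k ∸ 1) ^ 2 ℕ.+ 1) / 2 ≡ EvenOrder.D k
  dimension-formula k = trans (cong (_/ 2) (square+1 k)) (m*n/n≡m (EvenOrder.D k) 2)
    where
    open ℕ-Solver.+-*-Solver
    square+1 : ∀ k → (k ℕ.+ suc k) ^ 2 ℕ.+ 1 ≡ EvenOrder.D k ℕ.* 2
    square+1 = solve 1 (λ k → (k :+ (con 1 :+ k)) :^ 2 :+ con 1
                            := (k :* (k :+ (con 1 :+ k)) :+ (con 1 :+ k)) :* con 2) refl

  m+m≡m*2 : ∀ m → m ℕ.+ m ≡ m ℕ.* 2
  m+m≡m*2 = solve 1 (λ m → m :+ m := m :* con 2) refl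
    where open ℕ-Solver.+-*-Solver

  even-dimension : ∀ k → AffDim (Ωπ (suc k ℕ.* 2)) (((suc k ℕ.* 2 ∸ 1) ^ 2 ℕ.+ 1) / 2)
  even-dimension k =
    subst (λ n → AffDim (Ωπ n) (((n ∸ 1) ^ 2 ℕ.+ 1) / 2)) (m+m≡m*2 (suc k))
          (subst (AffDim (Ωπ _)) (sym (dimension-formula k)) (EvenOrder.dimension k))

open import Data.Nat using (ℕ; zero; suc; _<_; _∸_; _+_; _*_; _^_; _/_)
open import Data.Nat.Divisibility using (_∣_; divides)
open import Relation.Binary.PropositionalEquality using (refl)

theorem2p8 : (n : ℕ) → 0 < n → 2 ∣ n →
    AffDim (Ωπ n) (((n ∸ 1) ^ 2 + 1) / 2)
theorem2p8 .(zero * 2)  ()  (divides zero    refl)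
theorem2p8 .(suc k * 2) _   (divides (suc k) refl) = even-dimension k
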